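{- Let $\{\sigma_k:k\in\omega\}$ be the standard lexicographic enumeration of $2^{<\omega}$, and for $\sigma\in 2^{<\omega}$ let $[\sigma]=\{\tau\in 2^{<\omega}:\sigma\subseteq\tau\}$. Let $\pi$ be any permutation of $\omega$ and let $L\subseteq\omega$ be such that $[\sigma]\cap\{\sigma_k:k\in\pi(L)\}\neq\emptyset$ for all $\sigma\in 2^{<\omega}$. For $\sigma\in 2^{<\omega}$ set $a_{\sigma^\frown 0}=\{k\in\pi(L):\sigma_k\in[\sigma^\frown 1]\}$ and $a_{\sigma^\frown 1}=\omega\setminus a_{\sigma^\frown 0}$, and let $a_\emptyset=\emptyset$. Then $\{a_\sigma:\sigma\in 2^{<\omega}\}$ is a $\mathbb T$-algebra.
   Context: A sequence $\langle a_\alpha:\alpha<\lambda\rangle$ of subsets of $\omega$ is coherent if for all $\alpha\le\beta<\lambda$ there is finite $F\subseteq\alpha$ with $a_\alpha\cap a_\beta\subseteq a_F$ or $a_\alpha\subseteq a_\beta\cup a_F$ ($a_F=\bigcup_{\gamma\in F}a_\gamma$); proper if no $a_\beta$ is contained in a finite union of $a_\xi$'s with $\xi<\beta$. For $\sigma\in 2^{<\lambda}$, $\sigma^\dagger=\sigma$ if $\mathrm{dom}(\sigma)$ is not a successor, else $\sigma^\dagger$ differs from $\sigma$ exactly at $\max\mathrm{dom}(\sigma)$. A family $\langle a_\sigma:\sigma\in\Gamma\rangle$ of subsets of $\omega$ is a $\mathbb T$-algebra if for some ordinal $\lambda$: $\Gamma\subseteq 2^{<\lambda}$ is closed under initial segments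 and under $\dagger$; $a_\sigma=\emptyset$ when $\mathrm{dom}(\sigma)$ is not a successor; $a_{\sigma^\dagger}=\omega\setminus a_\sigma$ when $\mathrm{dom}(\sigma)$ is a successor; and for each $x\in 2^{\le\lambda}$, $\langle a_{x\restriction\alpha+1}: x\restriction\alpha+1\in\Gamma\rangle$ (indexed by $\alpha$) is a proper coherent sequence. -}

module Defs where

open import Data.Bool using (Bool; true; false; not; _∧_)
open import Data.Bool.Properties using () renaming (_≟_ to _≟ᴮ_)
open import Data.Nat using (ℕ; zero; suc; _<_; _≤_)
open import Data.Nat.Binary using (ℕᵇ; 2[1+_]; 1+[2_]) renaming (zero to zeroᵇ; fromℕ to toᵇ)
open import Data.List using (List; []; _∷_; _∷ʳ_; applyUpTo; take; length; unsnoc)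
open import Data.List.Relation.Unary.All using (All)
open import Data.List.Relation.Unary.Any using (Any)
open import Data.List.Relation.Binary.Prefix.Heterogeneous using (Prefix)
open import Data.List.Relation.Binary.Prefix.Heterogeneous.Properties using (prefix?)
open import Data.Maybe using (Maybe; just; nothing)
open import Data.Product using (Σ; _×_; _,_)
open import Data.Sum using (_⊎_)
open import Data.Unit using (⊤)
open import Relation.Nullary using (¬_)
open import Relation.Nullary.Decidable using (⌊_⌋)
open import Relation.Binary.PropositionalEquality using (_≡_)
open import Function.Bundles using (_↔_; Inverse)

-- Finite binary sequences (elements of 2^{<ω}); the list is read left to
-- right, i.e. σ = σ(0) ∷ σ(1) ∷ … ; false = 0, true = 1.
Seq : Set
Seq = List Bool

Subset : Set
Subset = ℕ → Bool

_⊑_ : Seq → Seq → Set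
σ ⊑ τ = Prefix _≡_ σ τ

_⊑?_ : Seq → Seq → Bool
σ ⊑? τ = ⌊ prefix? _≟ᴮ_ σ τ ⌋

-- Standard (length-then-lexicographic) enumeration σ_k of 2^{<ω}:
-- σ_0 = ∅, σ_1 = 0, σ_2 = 1, σ_3 = 00, σ_4 = 01, σ_5 = 10, σ_6 = 11, …
-- (σ_{2x+1} = σ_x ⌢ 0 and σ_{2x+2} = σ_x ⌢ 1), computed via binary ℕᵇ.
enumᵇ : ℕᵇ → Seq
enumᵇ zeroᵇ    = []
enumᵇ 1+[2 x ] = enumᵇ x ∷ʳ false
enumᵇ 2[1+ x ] = enumᵇ x ∷ʳ true

enum : ℕ → Seq
enum k = enumᵇ (toᵇ k)

image : ℕ ↔ ℕ → Subset → Subset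
image π L k = L (Inverse.from π k)

-- Coherent and proper sequences of subsets of ω.
-- A sequence is s : ℕ → Subset indexed on the (downward closed) index
-- set I ⊆ ω (I = all of ω, or I = {α : α < n}).

InUnion : (ℕ → Subset) → List ℕ → ℕ → Set
InUnion s F n = Any (λ γ → s γ n ≡ true) F

Coherent : (ℕ → Set) → (ℕ → Subset) → Set
Coherent I s = ∀ α β → I α → I β → α ≤ β →
  Σ (List ℕ) λ F → All (_< α) F ×
    ( (∀ n → s α n ≡ true → s β n ≡ true → InUnion s F n)
    ⊎ (∀ n → s α n ≡ true → s β n ≡ true ⊎ InUnion s F n))

Proper : (ℕ → Set) → (ℕ → Subset) → Set
Proper I s = ∀ β → I β → (F : List ℕ) → All (_< β) F →
  ¬ (∀ n → s β n ≡ true → InUnion s F n)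

ProperCoherent : (ℕ → Set) → (ℕ → Subset) → Set
ProperCoherent I s = Proper I s × Coherent I s

-- 𝕋-algebra with Γ = 2^{<ω} (all finite binary sequences), λ = ω.

restrict : (ℕ → Bool) → ℕ → Seq
restrict x n = applyUpTo x n

IsTAlgebra : (Seq → Subset) → Set
IsTAlgebra a =
  -- a_σ = ∅ when dom σ is not a successor (only σ = ∅)
  (∀ n → a [] n ≡ false)
  -- a_{σ†} = ω ∖ a_σ when dom σ is a successor
  × (∀ σ b n → a (σ ∷ʳ not b) n ≡ not (a (σ ∷ʳ b) n))
  × (∀ (x : ℕ → Bool) → ProperCoherent (λ _ → ⊤) (λ α → a (restrict x (suc α))))
  × (∀ (x : Seq) → ProperCoherent (λ α → α < length x) (λ α → a (take (suc α) x)))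

a0 : ℕ ↔ ℕ → Subset → Seq → Subset
a0 π L σ k = image π L k ∧ ((σ ∷ʳ true) ⊑? enum k)

family : ℕ ↔ ℕ → Subset → Seq → Subset
family π L τ k with unsnoc τ
... | nothing           = false
... | just (σ , false)  = a0 π L σ k
... | just (σ , true)   = not (a0 π L σ k)

-- Let τ_α = ρ_α ⌢ t_α be the nodes of a branch, so that a_{τ_α} = t_α xor a_{ρ_α⌢0}.
-- A point k of π(L) with σ_k above ρ_β lies above every earlier node τ_γ, and
-- a_{τ_γ} misses it. As a_{ρ_β⌢0} consists of such points, every earlier a_{τ_α}
-- misses a_{ρ_β⌢0}, so it is disjoint from a_{τ_β} or contained in it: the branch
-- is coherent with F = ∅. Properness: by density some k ∈ π(L) has σ_k above
-- the sibling of τ_β; it lies in a_{τ_β} but in no earlier a_{τ_γ}.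
module Submission where

open import Defs
open import Data.Nat using (ℕ)
open import Data.Bool using (true)
open import Relation.Nullary using (¬_)
open import Relation.Binary.PropositionalEquality using (_≡_)
open import Function.Bundles using (_↔_)

open import Data.Bool using (Bool; false; not; _xor_)
open import Data.Bool.Properties using (_≟_; xor-same; xor-identityʳ; xor-inverseʳ; not-distribˡ-xor; ¬-not; T-≡)
open import Data.Nat using (zero; suc; _<_; _≤_; z≤n; s≤s)
open import Data.Nat.Properties using (<-trans; m≤n⇒m<n∨m≡n)
open import Data.List using ([]; _∷_; _∷ʳ_; applyUpTo; take; length; unsnoc; initLast; _∷ʳ′_)
open import Data.List.Properties using (applyUpTo-∷ʳ)
open import Data.List.Relation.Unary.All using ([]; lookupAny)
import Data.List.Relation.Binary.Pointwise as Pointwise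
open import Data.List.Relation.Binary.Prefix.Heterogeneous using ([]; _∷_; _++ᵖ_)
open import Data.List.Relation.Binary.Prefix.Heterogeneous.Properties
  using (prefix?; fromPointwise) renaming (trans to prefix-trans)
open import Data.Maybe using (just)
open import Data.Product using (_×_; _,_)
open import Data.Sum using (inj₁; inj₂)
open import Data.Unit using (⊤; tt)
open import Function.Base using (_∘_)
open import Function.Bundles using (Equivalence)
open import Relation.Nullary using (Dec; contradiction)
open import Relation.Nullary.Decidable using (isYes≗does; dec-true; dec-false; toWitness)
open import Relation.Binary.PropositionalEquality using (refl; sym; trans; cong; subst; module ≡-Reasoning)

⊑-refl : (σ : Seq) → σ ⊑ σ
⊑-refl σ = fromPointwise (Pointwise.refl refl)

⊑-trans : {σ τ ρ : Seq} → σ ⊑ τ → τ ⊑ ρ → σ ⊑ ρ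
⊑-trans = prefix-trans trans

⊑-∷ʳ : (σ : Seq) (b : Bool) → σ ⊑ (σ ∷ʳ b)
⊑-∷ʳ σ b = ⊑-refl σ ++ᵖ (b ∷ [])

_⊑-dec_ : (σ ρ : Seq) → Dec (σ ⊑ ρ)
σ ⊑-dec ρ = prefix? _≟_ σ ρ

⊑?-sound : {σ ρ : Seq} → σ ⊑ ρ → (σ ⊑? ρ) ≡ true
⊑?-sound {σ} {ρ} p = trans (isYes≗does (σ ⊑-dec ρ)) (dec-true (σ ⊑-dec ρ) p)

⊑?-complete : {σ ρ : Seq} → (σ ⊑? ρ) ≡ true → σ ⊑ ρ
⊑?-complete e = toWitness (Equivalence.from T-≡ e)

∷ʳ-true-false-incomparable : (σ : Seq) {ρ : Seq} → (σ ∷ʳ true) ⊑ ρ → ¬ ((σ ∷ʳ false) ⊑ ρ)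
∷ʳ-true-false-incomparable []      (refl ∷ _) (() ∷ _)
∷ʳ-true-false-incomparable (_ ∷ σ) (_ ∷ p)    (_ ∷ q) = ∷ʳ-true-false-incomparable σ p q

⊑?-∷ʳ-true : (σ : Seq) (c : Bool) {ρ : Seq} → (σ ∷ʳ c) ⊑ ρ → ((σ ∷ʳ true) ⊑? ρ) ≡ c
⊑?-∷ʳ-true σ true  p = ⊑?-sound p
⊑?-∷ʳ-true σ false {ρ} p =
  trans (isYes≗does ((σ ∷ʳ true) ⊑-dec ρ))
        (dec-false ((σ ∷ʳ true) ⊑-dec ρ) λ q → ∷ʳ-true-false-incomparable σ q p)

initLast-∷ʳ : (σ : Seq) (b : Bool) → initLast (σ ∷ʳ b) ≡ (σ ∷ʳ′ b)
initLast-∷ʳ []      b = refl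
initLast-∷ʳ (_ ∷ σ) b rewrite initLast-∷ʳ σ b = refl

unsnoc-∷ʳ : (σ : Seq) (b : Bool) → unsnoc (σ ∷ʳ b) ≡ just (σ , b)
unsnoc-∷ʳ σ b rewrite initLast-∷ʳ σ b = refl

module _ (π : ℕ ↔ ℕ) (L : Subset) where

  open ≡-Reasoning

  Dense : Set
  Dense = ∀ σ → ¬ (∀ k → image π L k ≡ true → ¬ (σ ⊑ enum k))

  family-∷ʳ : (σ : Seq) (b : Bool) (k : ℕ) → family π L (σ ∷ʳ b) k ≡ b xor a0 π L σ k
  family-∷ʳ σ b k rewrite unsnoc-∷ʳ σ b with b
  ... | false = refl
  ... | true  = refl

  a0-above-child : {σ : Seq} {c : Bool} {k : ℕ} →
    image π L k ≡ true → (σ ∷ʳ c) ⊑ enum k → a0 π L σ k ≡ c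
  a0-above-child {σ} {c} d p rewrite d = ⊑?-∷ʳ-true σ c p

  a0-true : (σ : Seq) (k : ℕ) →
    a0 π L σ k ≡ true → image π L k ≡ true × (σ ∷ʳ true) ⊑ enum k
  a0-true σ k e with image π L k | (σ ∷ʳ true) ⊑? enum k in p
  ... | true  | true  = refl , ⊑?-complete p
  ... | true  | false = contradiction e λ ()
  ... | false | _     = contradiction e λ ()

  module Branch (dense : Dense) (I : ℕ → Set) (node parent : ℕ → Seq) (turn : ℕ → Bool)
    (I-downward : ∀ {α β} → I β → α < β → I α)
    (node≡ : ∀ {α} → I α → node α ≡ parent α ∷ʳ turn α)
    (node⊑parent : ∀ {α β} → I β → α < β → node α ⊑ parent β)
    where

    a : ℕ → Subset
    a α = family π L (node α)

    a-xor : ∀ {α} → I α → ∀ k → a α k ≡ turn α xor a0 π L (parent α) k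
    a-xor {α} iα k rewrite node≡ iα = family-∷ʳ (parent α) (turn α) k

    earlier-vanish : ∀ {β γ k} → I β → γ < β →
      image π L k ≡ true → parent β ⊑ enum k → a γ k ≡ false
    earlier-vanish {β} {γ} {k} iβ γ<β d p = begin
      a γ k                                ≡⟨ a-xor iγ k ⟩
      turn γ xor a0 π L (parent γ) k       ≡⟨ cong (turn γ xor_) (a0-above-child d node⊑k) ⟩
      turn γ xor turn γ                    ≡⟨ xor-same (turn γ) ⟩
      false                                ∎
      where
      iγ : I γ
      iγ = I-downward iβ γ<β
      node⊑k : (parent γ ∷ʳ turn γ) ⊑ enum k
      node⊑k = subst (_⊑ enum k) (node≡ iγ) (⊑-trans (node⊑parent iβ γ<β) p)

    proper : Proper I a
    proper β iβ F F<β a-β⊆a-F = dense (parent β ∷ʳ not (turn β)) λ k d p →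
      let a-β-k : a β k ≡ true
          a-β-k = begin
            a β k                                   ≡⟨ a-xor iβ k ⟩
            turn β xor a0 π L (parent β) k          ≡⟨ cong (turn β xor_) (a0-above-child d p) ⟩
            turn β xor not (turn β)                 ≡⟨ xor-inverseʳ (turn β) ⟩
            true                                    ∎
          γ<β , a-γ-k = lookupAny F<β (a-β⊆a-F k a-β-k)
      in contradiction (trans (sym a-γ-k) (earlier-vanish iβ γ<β d (⊑-trans (⊑-∷ʳ _ _) p))) λ ()

    later-constant-on-earlier : ∀ {α β} → I β → α < β →
      ∀ n → a α n ≡ true → a β n ≡ turn β
    later-constant-on-earlier {α} {β} iβ α<β n a-α-n = begin
      a β n                                ≡⟨ a-xor iβ n ⟩
      turn β xor a0 π L (parent β) n       ≡⟨ cong (turn β xor_) a0-false ⟩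
      turn β xor false                     ≡⟨ xor-identityʳ (turn β) ⟩
      turn β                               ∎
      where
      a0-false : a0 π L (parent β) n ≡ false
      a0-false = ¬-not λ e →
        let d , p = a0-true (parent β) n e
        in contradiction (trans (sym a-α-n) (earlier-vanish iβ α<β d (⊑-trans (⊑-∷ʳ _ _) p))) λ ()

    coherent : Coherent I a
    coherent α β iα iβ α≤β with m≤n⇒m<n∨m≡n α≤β | turn β in turn-β
    ... | inj₂ refl | _     = [] , [] , inj₂ λ n a-α-n → inj₁ a-α-n
    ... | inj₁ α<β  | false = [] , [] , inj₁ λ n a-α-n a-β-n →
      contradiction (trans (sym a-β-n) (trans (later-constant-on-earlier iβ α<β n a-α-n) turn-β)) λ ()
    ... | inj₁ α<β  | true  = [] , [] , inj₂ λ n a-α-n →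
      inj₁ (trans (later-constant-on-earlier iβ α<β n a-α-n) turn-β)

    properCoherent : ProperCoherent I a
    properCoherent = proper , coherent

applyUpTo-⊑ : (f : ℕ → Bool) {m n : ℕ} → m ≤ n → applyUpTo f m ⊑ applyUpTo f n
applyUpTo-⊑ f z≤n      = []
applyUpTo-⊑ f (s≤s le) = refl ∷ applyUpTo-⊑ (λ i → f (suc i)) le

take-⊑ : (x : Seq) {m n : ℕ} → m ≤ n → take m x ⊑ take n x
take-⊑ x       z≤n      = []
take-⊑ []      (s≤s le) = []
take-⊑ (b ∷ x) (s≤s le) = refl ∷ take-⊑ x le

-- The value past the end of the list is junk.
bit : Seq → ℕ → Bool
bit []      _       = false
bit (b ∷ _) zero    = b
bit (_ ∷ x) (suc α) = bit x α

take-suc-bit : (x : Seq) (α : ℕ) → α < length x → take (suc α) x ≡ take α x ∷ʳ bit x α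
take-suc-bit (b ∷ x) zero    _         = refl
take-suc-bit (b ∷ x) (suc α) (s≤s α<n) = cong (b ∷_) (take-suc-bit x α α<n)

proposition5p1 : (π : ℕ ↔ ℕ) (L : Subset) →
    (∀ σ → ¬ (∀ k → image π L k ≡ true → ¬ (σ ⊑ enum k))) →
    IsTAlgebra (family π L)
proposition5p1 π L dense = (λ _ → refl) , dagger , infinite , finite
  where
  open Branch π L dense using (properCoherent)

  dagger : ∀ σ b n → family π L (σ ∷ʳ not b) n ≡ not (family π L (σ ∷ʳ b) n)
  dagger σ b n rewrite family-∷ʳ π L σ (not b) n | family-∷ʳ π L σ b n =
    sym (not-distribˡ-xor b (a0 π L σ n))

  infinite : ∀ x → ProperCoherent (λ _ → ⊤) (λ α → family π L (restrict x (suc α)))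
  infinite x = properCoherent (λ _ → ⊤) (applyUpTo x ∘ suc) (applyUpTo x) x
    (λ _ _ → tt)
    (λ {α} _ → sym (applyUpTo-∷ʳ x α))
    (λ _ α<β → applyUpTo-⊑ x α<β)

  finite : ∀ x → ProperCoherent (λ α → α < length x) (λ α → family π L (take (suc α) x))
  finite x = properCoherent (λ α → α < length x) (λ α → take (suc α) x) (λ α → take α x) (bit x)
    (λ β<n α<β → <-trans α<β β<n)
    (λ {α} α<n → take-suc-bit x α α<n)
    (λ _ α<β → take-⊑ x α<β)
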